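{- A word $w$ over the alphabet $\{A_1,\overline{A}_1,\dots,A_m,\overline{A}_m\}$ is $2$-foldable if and only if it has an $A$-decomposition.
   Context: $A_i$ and $\overline{A}_i$ are called complements; for a letter $A$ (barred or unbarred), $\overline{A}$ denotes its complement. A plane tree is a rooted tree embedded in the plane with the root on top, children ordered left to right. Its half edges are ordered by starting at the root and tracing the perimeter counterclockwise, touching each side of each edge exactly once. For a word $w=w[1]\cdots w[2n]$ and a plane tree $T$ with $n$ edges, label the $i$-th half edge by $w[i]$; $T$ is $w$-valid if for each edge the two letters labeling it are complements. A word is foldable if some plane tree is $w$-valid (the empty word is foldable, via the one-vertex tree), and $k$-foldable if exactly $k$ plane trees are $w$-valid. An $A$-decomposition of $w$ is a choice of a letter $A$ (possibly barred) and words $u_1,u_2,u_3,v_1,v_2$ (possibly empty) such that (1) $w=u_1Av_1\overline{A}u_2Av_2\overline{A}u_3$; (2) the words $u_1u_3$, $u_2$, $v_1$, $v_2$ are foldable; and (3) the words $u_1u_2A\overline{A}u_3$ and $Av_1v_2\overline{A}$ are $1$-foldable. -}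

module Defs where

open import Data.Nat using (ℕ; suc)
open import Data.Fin using (Fin)
open import Data.Bool using (Bool; not)
open import Data.List using (List; []; _∷_; _++_; [_]; length)
open import Data.List.Relation.Unary.All using (All)
open import Data.List.Relation.Unary.Unique.Propositional using (Unique)
open import Data.List.Membership.Propositional using (_∈_)
open import Data.Product using (Σ; ∃; _×_; _,_)
open import Relation.Binary.PropositionalEquality using (_≡_)

-- Letters over {A_1, Ā_1, ..., A_m, Ā_m}: an index i : Fin m and a flag
-- (false = unbarred A_i, true = barred Ā_i).
Letter : ℕ → Set
Letter m = Fin m × Bool

comp : ∀ {m} → Letter m → Letter m
comp (i , b) = (i , not b)

Word : ℕ → Set
Word m = List (Letter m)

data PlaneTree : Set where
  node : List PlaneTree → PlaneTree

mutual
  edges : PlaneTree → ℕ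
  edges (node ts) = edgesF ts

  edgesF : List PlaneTree → ℕ
  edgesF [] = 0
  edgesF (t ∷ ts) = suc (edges t) Data.Nat.+ edgesF ts

-- Valid T w : labelling the half edges of T, in the counterclockwise
-- perimeter order starting at the root, by the successive letters of w
-- (w must have exactly 2·(#edges) letters) gives complementary labels on
-- the two sides of every edge.  For the root with children t₁ … t_k the
-- perimeter reads: down edge to t₁, perimeter of t₁, up edge from t₁,
-- down edge to t₂, …
mutual
  Valid : ∀ {m} → PlaneTree → Word m → Set
  Valid (node ts) w = ValidF ts w

  ValidF : ∀ {m} → List PlaneTree → Word m → Set
  ValidF [] w = w ≡ []
  ValidF {m} (t ∷ ts) w =
    Σ (Letter m) λ a → Σ (Word m) λ u → Σ (Word m) λ v →
      (w ≡ a ∷ u ++ comp a ∷ v) × Valid t u × ValidF ts v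

Foldable : ∀ {m} → Word m → Set
Foldable w = ∃ λ (T : PlaneTree) → Valid T w

KFoldable : ∀ {m} → ℕ → Word m → Set
KFoldable k w =
  Σ (List PlaneTree) λ Ts →
    (length Ts ≡ k) × Unique Ts × All (λ T → Valid T w) Ts ×
    (∀ T → Valid T w → T ∈ Ts)

ADecomposition : ∀ {m} → Word m → Set
ADecomposition {m} w =
  Σ (Letter m) λ A →
  Σ (Word m) λ u₁ → Σ (Word m) λ u₂ → Σ (Word m) λ u₃ →
  Σ (Word m) λ v₁ → Σ (Word m) λ v₂ →
    (w ≡ u₁ ++ A ∷ v₁ ++ comp A ∷ u₂ ++ A ∷ v₂ ++ comp A ∷ u₃) ×
    Foldable (u₁ ++ u₃) × Foldable u₂ × Foldable v₁ × Foldable v₂ ×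
    KFoldable 1 (u₁ ++ u₂ ++ A ∷ comp A ∷ u₃) ×
    KFoldable 1 (A ∷ v₁ ++ v₂ ++ [ comp A ])

module Submission where

-- A word is read as a walk in the Cayley tree of the free group on A₁, …, Aₘ, a letter and its
-- complement crossing the same edge in opposite directions. A w-valid plane tree pairs every letter
-- with a later complementary one crossing the same edge back, the pairs being non-crossing; so w is
-- foldable iff its walk is closed. If no edge is crossed more than twice the pairing is forced and w
-- has at most one valid tree. If some edge is crossed three (hence, the walk being closed, four)
-- times, its last four crossings split w as u₁ A v₁ Ā u₂ A v₂ Ā u₃ with closed pieces, and the first
-- A can be paired with either Ā. After rotating the word so that it starts with A, the trees are
-- exactly these two iff the words u₁u₂AĀu₃ and Av₁v₂Ā, which keep one arc each, cross every edge at
-- most twice, i.e. are 1-foldable.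

open import Defs
open import Data.Nat using (ℕ)
open import Function.Bundles using (_⇔_)
open import Function.Bundles using (mk⇔; module Equivalence)
open import Function.Base using (_∘_; case_of_)

open import Data.Nat using (zero; suc; _+_; _≤_; _<_; z≤n; s≤s; s≤s⁻¹; _≤?_)
import Data.Nat.Properties as ℕ
import Data.Fin.Properties as Fin
open import Data.Bool using (Bool; true; false; not; _∨_; if_then_else_)
import Data.Bool.Properties as Bool
open import Data.List using (List; []; _∷_; _++_; [_]; _∷ʳ_; length; map; reverse; initLast; _∷ʳ′_)
import Data.List.Properties as List
open import Data.Product using (∃; _×_; _,_; proj₁; proj₂)
import Data.Product.Properties as Product
open import Data.Sum using (_⊎_; inj₁; inj₂; [_,_]′)
open import Data.Maybe using (Maybe; just; nothing)
import Data.Maybe.Properties as Maybe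
open import Data.List.Membership.Propositional using (_∈_)
import Data.List.Membership.Propositional.Properties as Membership
open import Data.List.Relation.Unary.All using ([]; _∷_)
import Data.List.Relation.Unary.All as All
import Data.List.Relation.Unary.All.Properties as Allₚ
open import Data.List.Relation.Unary.AllPairs using ([]; _∷_)
open import Data.List.Relation.Unary.Any using (here; there)
import Data.List.Relation.Unary.Any as Any
import Data.List.Relation.Unary.Unique.Propositional.Properties as Unique
open import Data.Empty using (⊥; ⊥-elim)
open import Relation.Nullary using (Dec; yes; no; ¬_; does)
open import Relation.Nullary.Decidable using (dec-true; dec-false)
open import Relation.Binary.PropositionalEquality hiding ([_])
open import Relation.Binary.Definitions using (DecidableEquality)
open import Data.Nat.Tactic.RingSolver using (solve-∀)

m+n≡0⊎1≤m⊎1≤n : ∀ m n → m + n ≡ 0 ⊎ (1 ≤ m ⊎ 1 ≤ n)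
m+n≡0⊎1≤m⊎1≤n zero zero = inj₁ refl
m+n≡0⊎1≤m⊎1≤n zero (suc n) = inj₂ (inj₂ (s≤s z≤n))
m+n≡0⊎1≤m⊎1≤n (suc m) n = inj₂ (inj₁ (s≤s z≤n))

m+2+n≤2⇒m≡n≡0 : ∀ m n → m + suc (suc n) ≤ 2 → m ≡ 0 × n ≡ 0
m+2+n≤2⇒m≡n≡0 zero zero _ = refl , refl
m+2+n≤2⇒m≡n≡0 zero (suc n) (s≤s (s≤s ()))
m+2+n≤2⇒m≡n≡0 (suc m) n (s≤s h) with s≤s () ← ℕ.≤-trans (ℕ.m≤n+m (suc (suc n)) m) h

arcBounds : ∀ i a b c d → b + (i + (i + d)) ≤ 2 → a + (i + (i + c)) ≤ 2 → a + c ≡ 0 ⊎ b + d ≡ 0 →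
            b + (i + (c + (i + d))) ≤ 2 × a + (i + (b + (i + c))) ≤ 2
arcBounds i a b c d outer inner (inj₁ a+c≡0)
  with refl ← ℕ.m+n≡0⇒m≡0 a a+c≡0 | refl ← ℕ.m+n≡0⇒n≡0 a a+c≡0 =
  outer ,
  ℕ.≤-trans (ℕ.≤-reflexive (shuffle i b)) (ℕ.≤-trans (ℕ.+-monoʳ-≤ b (ℕ.+-monoʳ-≤ i (ℕ.+-monoʳ-≤ i z≤n))) outer)
  where
  shuffle : ∀ i b → i + (b + (i + 0)) ≡ b + (i + (i + 0))
  shuffle = solve-∀
arcBounds i a b c d outer inner (inj₂ b+d≡0)
  with refl ← ℕ.m+n≡0⇒m≡0 b b+d≡0 | refl ← ℕ.m+n≡0⇒n≡0 b b+d≡0 =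
  ℕ.≤-trans (ℕ.≤-reflexive (shuffle i c)) (ℕ.≤-trans (ℕ.m≤n+m _ a) inner) , inner
  where
  shuffle : ∀ i c → i + (c + (i + 0)) ≡ i + (i + c)
  shuffle = solve-∀

module _ {A : Set} where

  data CompareSplits (x : List A) (c : A) (y p : List A) (d : A) (q : List A) : Set where
    same : x ≡ p → c ≡ d → y ≡ q → CompareSplits x c y p d q
    before : ∀ mid → p ≡ x ++ c ∷ mid → y ≡ mid ++ d ∷ q → CompareSplits x c y p d q
    after : ∀ mid → x ≡ p ++ d ∷ mid → q ≡ mid ++ c ∷ y → CompareSplits x c y p d q

  compareSplits : ∀ x c y p d q → x ++ c ∷ y ≡ p ++ d ∷ q → CompareSplits x c y p d q
  compareSplits [] c y [] d q refl = same refl refl refl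
  compareSplits [] c y (_ ∷ p) d q refl = before p refl refl
  compareSplits (_ ∷ x) c y [] d q refl = after x refl refl
  compareSplits (_ ∷ x) c y (_ ∷ p) d q e
    with refl , e′ ← List.∷-injective e with compareSplits x c y p d q e′
  ... | same refl c≡d y≡q = same refl c≡d y≡q
  ... | before mid refl y≡ = before mid refl y≡
  ... | after mid refl q≡ = after mid refl q≡

module _ {m : ℕ} where

  private
    L = Letter m
    W = Word m

  infix 4 _≟ᴸ_ _≟ᵂ_

  _≟ᴸ_ : DecidableEquality L
  _≟ᴸ_ = Product.≡-dec Fin._≟_ Bool._≟_

  _≟ᵂ_ : DecidableEquality W
  _≟ᵂ_ = List.≡-dec _≟ᴸ_

  comp-involutive : (x : L) → comp (comp x) ≡ x
  comp-involutive (_ , false) = refl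
  comp-involutive (_ , true) = refl

  comp≢self : (x : L) → comp x ≢ x
  comp≢self (_ , false) ()
  comp≢self (_ , true) ()

  comp-surjective : ∀ (x : L) → ∃ λ a → x ≡ comp a
  comp-surjective x = comp x , sym (comp-involutive x)

  -- Free reduction. The Cayley graph of the free group is a tree, and an edge is named by its
  -- endpoint farther from the identity (the longer reduced word).

  Cancels : L → W → Set
  Cancels x v = ∃ λ v′ → v ≡ comp x ∷ v′

  cancels? : ∀ x v → Dec (Cancels x v)
  cancels? x [] = no λ ()
  cancels? x (y ∷ v) with y ≟ᴸ comp x
  ... | yes refl = yes (v , refl)
  ... | no y≢x̄ = no λ (_ , eq) → y≢x̄ (List.∷-injectiveˡ eq)

  private
    stepWith : (x : L) (v : W) → Dec (Cancels x v) → W × W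
    stepWith x v (yes (v′ , _)) = v′ , v
    stepWith x v (no _) = x ∷ v , x ∷ v

  infixr 5 _∙_

  _∙_ : L → W → W
  x ∙ v = proj₁ (stepWith x v (cancels? x v))

  edge : L → W → W
  edge x v = proj₂ (stepWith x v (cancels? x v))

  data StepView (x : L) (v : W) : Set where
    cancelling : ∀ v′ → v ≡ comp x ∷ v′ → x ∙ v ≡ v′ → edge x v ≡ v → StepView x v
    extending : (∀ v′ → v ≢ comp x ∷ v′) → x ∙ v ≡ x ∷ v → edge x v ≡ x ∷ v → StepView x v

  stepView : ∀ x v → StepView x v
  stepView x v with cancels? x v in eq
  ... | yes (v′ , v≡) = cancelling v′ v≡ (cong (proj₁ ∘ stepWith x v) eq) (cong (proj₂ ∘ stepWith x v) eq)
  ... | no ¬c =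
    extending (λ v′ q → ¬c (v′ , q)) (cong (proj₁ ∘ stepWith x v) eq) (cong (proj₂ ∘ stepWith x v) eq)

  data Reduced : W → Set where
    [] : Reduced []
    _∷_ : ∀ {x v} → (∀ v′ → v ≢ comp x ∷ v′) → Reduced v → Reduced (x ∷ v)

  -- w ⋆ r is the end of the walk in the Cayley tree that starts at r and reads w
  -- from right to left.
  infixr 5 _⋆_

  _⋆_ : W → W → W
  [] ⋆ r = r
  (x ∷ w) ⋆ r = x ∙ (w ⋆ r)

  ⋆-++ : ∀ p q r → (p ++ q) ⋆ r ≡ p ⋆ q ⋆ r
  ⋆-++ [] q r = refl
  ⋆-++ (x ∷ p) q r = cong (x ∙_) (⋆-++ p q r)

  ⋆-++-prefix : ∀ p q {b c b′} → (p ++ q) ⋆ b ≡ b′ → q ⋆ b ≡ c → p ⋆ c ≡ b′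
  ⋆-++-prefix p q {b} h hq = trans (cong (p ⋆_) (sym hq)) (trans (sym (⋆-++ p q b)) h)

  ∙-reduced : ∀ x {v} → Reduced v → Reduced (x ∙ v)
  ∙-reduced x {v} rv with stepView x v
  ... | cancelling v′ refl e _ rewrite e with rv
  ...   | _ ∷ rv′ = rv′
  ∙-reduced x {v} rv | extending ne e _ rewrite e = ne ∷ rv

  ⋆-reduced : ∀ w {r} → Reduced r → Reduced (w ⋆ r)
  ⋆-reduced [] rr = rr
  ⋆-reduced (x ∷ w) rr = ∙-reduced x (⋆-reduced w rr)

  ∙-inverseˡ : ∀ x {r} → Reduced r → x ∙ comp x ∙ r ≡ r
  ∙-inverseˡ x {r} rr with stepView (comp x) r
  ... | extending _ e _ rewrite e with stepView x (comp x ∷ r)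
  ...   | cancelling _ eq e′ _ rewrite e′ = sym (List.∷-injectiveʳ eq)
  ...   | extending ne _ _ = ⊥-elim (ne r refl)
  ∙-inverseˡ x {r} rr | cancelling v′ refl e _ rewrite e with rr
  ...   | ne ∷ _ with stepView x v′
  ...     | cancelling v″ eq _ _ = ⊥-elim (ne v″ (trans eq (cong (_∷ v″) (sym (comp-involutive (comp x))))))
  ...     | extending _ e′ _ rewrite e′ = cong (_∷ v′) (sym (comp-involutive x))

  edge-∙-comp : ∀ x {r} → Reduced r → edge x (comp x ∙ r) ≡ edge (comp x) r
  edge-∙-comp x {r} rr with stepView (comp x) r
  ... | extending _ e₁ e₂ rewrite e₁ | e₂ with stepView x (comp x ∷ r)
  ...   | cancelling _ _ _ e = e
  ...   | extending ne _ _ = ⊥-elim (ne r refl)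
  edge-∙-comp x {r} rr | cancelling v′ refl e₁ e₂ rewrite e₁ | e₂ with rr
  ...   | ne ∷ _ with stepView x v′
  ...     | cancelling v″ eq _ _ = ⊥-elim (ne v″ (trans eq (cong (_∷ v″) (sym (comp-involutive (comp x))))))
  ...     | extending _ _ e = trans e (cong (_∷ v′) (sym (comp-involutive x)))

  -- The vertex v lies on the far side of the edge E from the identity, i.e. E is a suffix of v.
  beyond : W → W → Bool
  beyond E [] = false
  beyond E (c ∷ v) = does (c ∷ v ≟ᵂ E) ∨ beyond E v

  beyond⇒length≤ : ∀ E v → beyond E v ≡ true → length E ≤ length v
  beyond⇒length≤ E (c ∷ v) h with c ∷ v ≟ᵂ E
  ... | yes refl = ℕ.≤-refl
  ... | no _ = ℕ.m≤n⇒m≤1+n (beyond⇒length≤ E v h)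

  beyond-self : ∀ c v → beyond (c ∷ v) (c ∷ v) ≡ true
  beyond-self c v = cong (_∨ beyond (c ∷ v) v) (dec-true (c ∷ v ≟ᵂ c ∷ v) refl)

  beyond-∷ : ∀ E c v → c ∷ v ≢ E → beyond E (c ∷ v) ≡ beyond E v
  beyond-∷ E c v ne = cong (_∨ beyond E v) (dec-false (c ∷ v ≟ᵂ E) ne)

  beyond-tail : ∀ c v → beyond (c ∷ v) v ≡ false
  beyond-tail c v with beyond (c ∷ v) v in eq
  ... | false = refl
  ... | true = ⊥-elim (ℕ.<-irrefl refl (beyond⇒length≤ (c ∷ v) v eq))

  beyond-∙ : ∀ E x v → edge x v ≢ E → beyond E (x ∙ v) ≡ beyond E v
  beyond-∙ E x v ne with stepView x v
  ... | cancelling v′ refl e₁ e₂ rewrite e₁ = sym (beyond-∷ E (comp x) v′ (λ q → ne (trans e₂ q)))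
  ... | extending _ e₁ e₂ rewrite e₁ = beyond-∷ E x v (λ q → ne (trans e₂ q))

  beyond-∙-crossing : ∀ {E} x v → edge x v ≡ E → beyond E (x ∙ v) ≡ not (beyond E v)
  beyond-∙-crossing x v refl with stepView x v
  ... | cancelling v′ refl e₁ e₂ rewrite e₁ | e₂ =
        trans (beyond-tail (comp x) v′) (cong not (sym (beyond-self (comp x) v′)))
  ... | extending _ e₁ e₂ rewrite e₁ | e₂ =
        trans (beyond-self x v) (cong not (sym (beyond-tail x v)))

  crossingStep : W → Bool → Maybe (L × W)
  crossingStep [] _ = nothing
  crossingStep (c ∷ E) true = just (comp c , c ∷ E)
  crossingStep (c ∷ E) false = just (c , E)

  crossingStep-edge : ∀ x v → crossingStep (edge x v) (beyond (edge x v) v) ≡ just (x , v)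
  crossingStep-edge x v with stepView x v
  ... | cancelling v′ refl _ e rewrite e | beyond-self (comp x) v′ =
        cong (λ y → just (y , comp x ∷ v′)) (comp-involutive x)
  ... | extending _ _ e rewrite e | beyond-tail x v = refl

  crossing-from-same-side : ∀ {E} x v y u → edge x v ≡ E → edge y u ≡ E →
                            beyond E v ≡ beyond E u → x ≡ y × v ≡ u
  crossing-from-same-side x v y u refl ey sameSide =
    Product.,-injective (Maybe.just-injective (begin
      just (x , v)                                  ≡⟨ crossingStep-edge x v ⟨
      crossingStep (edge x v) (beyond (edge x v) v) ≡⟨ cong (crossingStep (edge x v)) sameSide ⟩
      crossingStep (edge x v) (beyond (edge x v) u) ≡⟨ cong (λ E → crossingStep E (beyond E u)) ey ⟨
      crossingStep (edge y u) (beyond (edge y u) u) ≡⟨ crossingStep-edge y u ⟩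
      just (y , u)                                  ∎))
    where open ≡-Reasoning

  hits : W → W → ℕ
  hits E e = if does (e ≟ᵂ E) then 1 else 0

  hits-≡ : ∀ {E e} → e ≡ E → hits E e ≡ 1
  hits-≡ {E} {e} e≡E = cong (if_then 1 else 0) (dec-true (e ≟ᵂ E) e≡E)

  crossings : W → W → W → ℕ
  crossings E [] r = 0
  crossings E (x ∷ w) r = hits E (edge x (w ⋆ r)) + crossings E w r

  crossings-++ : ∀ E p q r → crossings E (p ++ q) r ≡ crossings E p (q ⋆ r) + crossings E q r
  crossings-++ E [] q r = refl
  crossings-++ E (x ∷ p) q r rewrite ⋆-++ p q r | crossings-++ E p q r =
    sym (ℕ.+-assoc (hits E (edge x (p ⋆ q ⋆ r))) (crossings E p (q ⋆ r)) (crossings E q r))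

  flips : ℕ → Bool → Bool
  flips zero b = b
  flips (suc n) b = not (flips n b)

  beyond-⋆ : ∀ E s b → beyond E (s ⋆ b) ≡ flips (crossings E s b) (beyond E b)
  beyond-⋆ E [] b = refl
  beyond-⋆ E (x ∷ s) b with edge x (s ⋆ b) ≟ᵂ E
  ... | yes e = trans (beyond-∙-crossing x (s ⋆ b) e) (cong not (beyond-⋆ E s b))
  ... | no ne = trans (beyond-∙ E x (s ⋆ b) ne) (beyond-⋆ E s b)

  beyond-⋆-uncrossed : ∀ E s {b} → crossings E s b ≡ 0 → beyond E (s ⋆ b) ≡ beyond E b
  beyond-⋆-uncrossed E s {b} h = trans (beyond-⋆ E s b) (cong (λ n → flips n (beyond E b)) h)

  closed⇒crossings≢3 : ∀ E s {b} → s ⋆ b ≡ b → crossings E s b ≢ 3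
  closed⇒crossings≢3 E s {b} closed three =
    Bool.not-¬ refl (trans (sym (cong (beyond E) closed))
      (trans (beyond-⋆ E s b) (trans (cong (λ n → flips n (beyond E b)) three) (Bool.not-involutive _))))

  edge-endpoint : ∀ x v → edge x v ≡ v ⊎ edge x v ≡ x ∙ v
  edge-endpoint x v with stepView x v
  ... | cancelling _ _ _ e = inj₁ e
  ... | extending _ e₁ e₂ = inj₂ (trans e₂ (sym e₁))

  beyond-crossed-edge : ∀ E E′ s {b} → crossings E s b ≡ 0 → 1 ≤ crossings E′ s b →
                        beyond E E′ ≡ beyond E b
  beyond-crossed-edge E E′ (x ∷ s) {b} h h′ with edge x (s ⋆ b) ≟ᵂ E′ | edge-endpoint x (s ⋆ b)
  ... | no _ | _ = beyond-crossed-edge E E′ s (ℕ.m+n≡0⇒n≡0 _ h) h′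
  ... | yes refl | inj₁ e = trans (cong (beyond E) e) (beyond-⋆-uncrossed E s (ℕ.m+n≡0⇒n≡0 _ h))
  ... | yes refl | inj₂ e = trans (cong (beyond E) e) (beyond-⋆-uncrossed E (x ∷ s) h)

  -- Valid forests are exactly the closed walks

  Forest : W → Set
  Forest w = ∃ λ ts → ValidF {m} ts w

  foldable⇒forest : ∀ {w : W} → Foldable w → Forest w
  foldable⇒forest (node ts , v) = ts , v

  forest⇒foldable : ∀ {w : W} → Forest w → Foldable w
  forest⇒foldable (ts , v) = node ts , v

  ValidF-closed : ∀ ts {w} → ValidF {m} ts w → ∀ {r} → Reduced r → w ⋆ r ≡ r
  ValidF-closed [] refl rr = refl
  ValidF-closed (node us ∷ ts) (a , u , v , refl , vu , vv) {r} rr = begin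
    a ∙ (u ++ comp a ∷ v) ⋆ r   ≡⟨ cong (a ∙_) (⋆-++ u (comp a ∷ v) r) ⟩
    a ∙ u ⋆ comp a ∙ v ⋆ r      ≡⟨ cong (λ z → a ∙ u ⋆ comp a ∙ z) (ValidF-closed ts vv rr) ⟩
    a ∙ u ⋆ comp a ∙ r          ≡⟨ cong (a ∙_) (ValidF-closed us vu (∙-reduced (comp a) rr)) ⟩
    a ∙ comp a ∙ r              ≡⟨ ∙-inverseˡ a rr ⟩
    r                           ∎
    where open ≡-Reasoning

  ValidF-++ : ∀ ts ts′ {u v} → ValidF {m} ts u → ValidF {m} ts′ v → ValidF {m} (ts ++ ts′) (u ++ v)
  ValidF-++ [] ts′ refl vv = vv
  ValidF-++ (node _ ∷ ts) ts′ {v = v} (a , p , q , refl , vp , vq) vv =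
    a , p , q ++ v , cong (a ∷_) (List.++-assoc p (comp a ∷ q) v) , vp , ValidF-++ ts ts′ vq vv

  ValidF-split : ∀ ts ts′ {w} → ValidF {m} (ts ++ ts′) w →
                 ∃ λ u → ∃ λ v → w ≡ u ++ v × ValidF {m} ts u × ValidF {m} ts′ v
  ValidF-split [] ts′ vw = [] , _ , refl , refl , vw
  ValidF-split (node _ ∷ ts) ts′ (a , p , q , refl , vp , vq) with ValidF-split ts ts′ vq
  ... | u , v , refl , vu , vv =
    a ∷ p ++ comp a ∷ u , v , cong (a ∷_) (sym (List.++-assoc p (comp a ∷ u) v)) ,
    (a , p , u , refl , vp , vu) , vv

  ValidF-length : ∀ ts {w w′} → ValidF {m} ts w → ValidF {m} ts w′ → length w ≡ length w′
  ValidF-length [] refl refl = refl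
  ValidF-length (node us ∷ ts) (_ , u , v , refl , vu , vv) (_ , u′ , v′ , refl , vu′ , vv′) =
    cong suc (begin
      length (u ++ _ ∷ v)    ≡⟨ List.length-++ u ⟩
      length u + suc (length v)   ≡⟨ cong₂ (λ i j → i + suc j) (ValidF-length us vu vu′) (ValidF-length ts vv vv′) ⟩
      length u′ + suc (length v′) ≡⟨ List.length-++ u′ ⟨
      length (u′ ++ _ ∷ v′)  ∎)
    where open ≡-Reasoning

  ⋆-[] : ∀ {s} → Reduced s → s ⋆ [] ≡ s
  ⋆-[] [] = refl
  ⋆-[] (_∷_ {x} {s} ne rs) rewrite ⋆-[] rs with stepView x s
  ... | cancelling v′ eq _ _ = ⊥-elim (ne v′ eq)
  ... | extending _ e _ = e

  ∙-⋆ : ∀ x {s r} → Reduced s → Reduced r → (x ∙ s) ⋆ r ≡ x ∙ s ⋆ r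
  ∙-⋆ x {s} {r} rs rr with stepView x s
  ... | cancelling s′ refl e _ rewrite e = sym (∙-inverseˡ x (⋆-reduced s′ rr))
  ... | extending _ e _ rewrite e = refl

  ⋆-normalise : ∀ w {r} → Reduced r → w ⋆ r ≡ (w ⋆ []) ⋆ r
  ⋆-normalise [] rr = refl
  ⋆-normalise (x ∷ w) {r} rr =
    trans (cong (x ∙_) (⋆-normalise w rr)) (sym (∙-⋆ x (⋆-reduced w []) rr))

  inverse : W → W
  inverse [] = []
  inverse (x ∷ r) = inverse r ++ [ comp x ]

  ⋆-inverseʳ : ∀ r {q} → Reduced q → (r ++ inverse r) ⋆ q ≡ q
  ⋆-inverseʳ [] rq = refl
  ⋆-inverseʳ (x ∷ r) {q} rq = begin
    x ∙ (r ++ inverse r ++ [ comp x ]) ⋆ q   ≡⟨ cong (λ z → x ∙ z ⋆ q) (List.++-assoc r (inverse r) [ comp x ]) ⟨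
    x ∙ ((r ++ inverse r) ++ [ comp x ]) ⋆ q ≡⟨ cong (x ∙_) (⋆-++ (r ++ inverse r) [ comp x ] q) ⟩
    x ∙ (r ++ inverse r) ⋆ comp x ∙ q        ≡⟨ cong (x ∙_) (⋆-inverseʳ r (∙-reduced (comp x) rq)) ⟩
    x ∙ comp x ∙ q                           ≡⟨ ∙-inverseˡ x rq ⟩
    q                                        ∎
    where open ≡-Reasoning

  reduced-fixing-vertex : ∀ {s r} → Reduced s → Reduced r → s ⋆ r ≡ r → s ≡ []
  reduced-fixing-vertex {s} {r} rs rr h = begin
    s                        ≡⟨ ⋆-[] rs ⟨
    s ⋆ []                   ≡⟨ cong (s ⋆_) (⋆-inverseʳ r []) ⟨
    s ⋆ (r ++ inverse r) ⋆ [] ≡⟨ cong (s ⋆_) (⋆-++ r (inverse r) []) ⟩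
    s ⋆ r ⋆ t                ≡⟨ ⋆-++ s r t ⟨
    (s ++ r) ⋆ t             ≡⟨ ⋆-normalise (s ++ r) (⋆-reduced (inverse r) []) ⟩
    ((s ++ r) ⋆ []) ⋆ t      ≡⟨ cong (λ z → z ⋆ t) (trans (⋆-++ s r []) (cong (s ⋆_) (⋆-[] rr))) ⟩
    (s ⋆ r) ⋆ t              ≡⟨ cong (_⋆ t) h ⟩
    r ⋆ t                    ≡⟨ ⋆-++ r (inverse r) [] ⟨
    (r ++ inverse r) ⋆ []    ≡⟨ ⋆-inverseʳ r [] ⟩
    []                       ∎
    where
    open ≡-Reasoning
    t : W
    t = inverse r ⋆ []

  ForestsAround : W → W → Set
  ForestsAround w [] = Forest w
  ForestsAround w (x ∷ s) = ∃ λ g → ∃ λ t → w ≡ g ++ x ∷ t × Forest g × ForestsAround t s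

  forestsAround-prepend : ∀ h {t} s → Forest h → ForestsAround t s → ForestsAround (h ++ t) s
  forestsAround-prepend h [] (hs , vh) (ts , vt) = hs ++ ts , ValidF-++ hs ts vh vt
  forestsAround-prepend h (y ∷ s) (hs , vh) (g , t′ , refl , (gs , vg) , ft) =
    h ++ g , t′ , sym (List.++-assoc h g (y ∷ t′)) , (hs ++ gs , ValidF-++ hs gs vh vg) , ft

  -- A letter x cancelling against comp x closes an arc around the foldable word in between.
  forestsAround-⋆ : ∀ w → ForestsAround w (w ⋆ [])
  forestsAround-⋆ [] = [] , refl
  forestsAround-⋆ (x ∷ w) with w ⋆ [] | forestsAround-⋆ w | stepView x (w ⋆ [])
  ... | s | fs | extending _ e _ rewrite e = [] , w , refl , ([] , refl) , fs
  ... | .(comp x ∷ s′) | (g , t , refl , (gs , vg) , ft) | cancelling s′ refl e _ rewrite e =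
    subst (λ z → ForestsAround z s′) (List.++-assoc (x ∷ g) [ comp x ] t)
      (forestsAround-prepend (x ∷ g ++ [ comp x ]) s′ ([ node gs ] , x , g , [] , refl , vg , refl) ft)

  closed⇒forest : ∀ w {b} → Reduced b → w ⋆ b ≡ b → Forest w
  closed⇒forest w {b} rb h =
    subst (ForestsAround w)
      (reduced-fixing-vertex (⋆-reduced w []) rb (trans (sym (⋆-normalise w rb)) h))
      (forestsAround-⋆ w)

  record _≅_ (w w′ : W) : Set where
    field
      to from : PlaneTree → PlaneTree
      from∘to : ∀ T → from (to T) ≡ T
      to∘from : ∀ T → to (from T) ≡ T
      to-valid : ∀ {T} → Valid T w → Valid (to T) w′
      from-valid : ∀ {T} → Valid T w′ → Valid (from T) w

    to-injective : ∀ {T T′} → to T ≡ to T′ → T ≡ T′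
    to-injective {T} {T′} e = trans (sym (from∘to T)) (trans (cong from e) (from∘to T′))

  ≅-sym : ∀ {w w′} → w ≅ w′ → w′ ≅ w
  ≅-sym I = record { to = from ; from = to ; from∘to = to∘from ; to∘from = from∘to
                   ; to-valid = from-valid ; from-valid = to-valid }
    where open _≅_ I

  ≅-trans : ∀ {w w′ w″} → w ≅ w′ → w′ ≅ w″ → w ≅ w″
  ≅-trans I J = record
    { to = J.to ∘ I.to ; from = I.from ∘ J.from
    ; from∘to = λ T → trans (cong I.from (J.from∘to (I.to T))) (I.from∘to T)
    ; to∘from = λ T → trans (cong J.to (I.to∘from (J.from T))) (J.to∘from T)
    ; to-valid = J.to-valid ∘ I.to-valid ; from-valid = I.from-valid ∘ J.from-valid }
    where
    module I = _≅_ I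
    module J = _≅_ J

  ≡⇒≅ : ∀ {w w′} → w ≡ w′ → w ≅ w′
  ≡⇒≅ refl = record { to = λ T → T ; from = λ T → T ; from∘to = λ _ → refl ; to∘from = λ _ → refl
                    ; to-valid = λ v → v ; from-valid = λ v → v }

  -- Rotating the word by one letter makes the first child of the root the new root.
  rotate : PlaneTree → PlaneTree
  rotate (node []) = node []
  rotate (node (node us ∷ ts)) = node (us ∷ʳ node ts)

  private
    unrotateRev : List PlaneTree → PlaneTree
    unrotateRev [] = node []
    unrotateRev (node ls ∷ rest) = node (node (reverse rest) ∷ ls)

  unrotate : PlaneTree → PlaneTree
  unrotate (node ts) = unrotateRev (reverse ts)

  unrotate-rotate : ∀ T → unrotate (rotate T) ≡ T
  unrotate-rotate (node []) = refl
  unrotate-rotate (node (node us ∷ ts))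
    rewrite List.reverse-++ us [ node ts ] | List.reverse-involutive us = refl

  unrotate-∷ʳ : ∀ init ls → unrotate (node (init ∷ʳ node ls)) ≡ node (node init ∷ ls)
  unrotate-∷ʳ init ls rewrite List.reverse-++ init [ node ls ] | List.reverse-involutive init = refl

  rotate-unrotate : ∀ T → rotate (unrotate T) ≡ T
  rotate-unrotate (node ts) with initLast ts
  ... | [] = refl
  ... | init ∷ʳ′ node ls = cong rotate (unrotate-∷ʳ init ls)

  rotate-valid : ∀ {T} (x : L) w → Valid T (x ∷ w) → Valid (rotate T) (w ∷ʳ x)
  rotate-valid {node (node us ∷ ts)} x w (a , u , v , refl , vu , vv) =
    subst (ValidF (us ∷ʳ node ts)) (sym (List.++-assoc u (comp a ∷ v) [ a ]))
      (ValidF-++ us [ node ts ] vu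
        (comp a , v , [] , cong (λ z → comp a ∷ v ++ [ z ]) (sym (comp-involutive a)) , vv , refl))

  unrotate-valid : ∀ {T} (x : L) w → Valid T (w ∷ʳ x) → Valid (unrotate T) (x ∷ w)
  unrotate-valid {node ts} x w vt with initLast ts
  ... | [] with () ← List.++-conicalʳ w [ x ] vt
  ... | init ∷ʳ′ node ls with ValidF-split init [ node ls ] vt
  ...   | u , _ , eq , vu , (b , v , _ , refl , vl , refl)
    with List.∷ʳ-injective w (u ++ b ∷ v) (trans eq (sym (List.++-assoc u (b ∷ v) [ comp b ])))
  ...     | refl , refl =
    subst (λ T → Valid T (comp b ∷ u ++ b ∷ v)) (sym (unrotate-∷ʳ init ls))
      (comp b , u , v , cong (λ z → comp b ∷ u ++ z ∷ v) (sym (comp-involutive b)) , vu , vl)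

  rotate-≅ : ∀ (x : L) w → (x ∷ w) ≅ (w ∷ʳ x)
  rotate-≅ x w = record
    { to = rotate ; from = unrotate ; from∘to = unrotate-rotate ; to∘from = rotate-unrotate
    ; to-valid = λ {T} → rotate-valid {T} x w ; from-valid = λ {T} → unrotate-valid {T} x w }

  ++-comm-≅ : ∀ p q → (p ++ q) ≅ (q ++ p)
  ++-comm-≅ [] q = ≡⇒≅ (sym (List.++-identityʳ q))
  ++-comm-≅ (x ∷ p) q =
    ≅-trans (rotate-≅ x (p ++ q))
      (≅-trans (≡⇒≅ (List.++-assoc p q [ x ]))
        (≅-trans (++-comm-≅ p (q ∷ʳ x)) (≡⇒≅ (List.++-assoc q [ x ] p))))

  AtMostOneTree : W → Set
  AtMostOneTree w = ∀ {T T′} → Valid T w → Valid T′ w → T ≡ T′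

  ≅-atMostOneTree : ∀ {w w′} → w ≅ w′ → AtMostOneTree w → AtMostOneTree w′
  ≅-atMostOneTree I amo {T} {T′} v v′ =
    trans (sym (to∘from T)) (trans (cong to (amo (from-valid v) (from-valid v′))) (to∘from T′))
    where open _≅_ I

  ≅-foldable : ∀ {w w′} → w ≅ w′ → Foldable w → Foldable w′
  ≅-foldable I (T , v) = to T , to-valid v
    where open _≅_ I

  ≅-kFoldable : ∀ {w w′} k → w ≅ w′ → KFoldable k w → KFoldable k w′
  ≅-kFoldable k I (Ts , len , unique , valid , complete) =
    map to Ts , trans (List.length-map to Ts) len , Unique.map⁺ to-injective unique ,
    Allₚ.map⁺ (All.map to-valid valid) ,
    λ T v → subst (_∈ map to Ts) (to∘from T) (Membership.∈-map⁺ to (complete (from T) (from-valid v)))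
    where open _≅_ I

  oneFoldable-intro : ∀ {w : W} {T} → Valid T w → (∀ T′ → Valid T′ w → T′ ≡ T) → KFoldable 1 w
  oneFoldable-intro {T = T} v only = [ T ] , refl , [] ∷ [] , v ∷ [] , λ T′ v′ → here (only T′ v′)

  oneFoldable-elim : ∀ {w : W} → KFoldable 1 w → Foldable w × AtMostOneTree w
  oneFoldable-elim ((T ∷ []) , refl , _ , v ∷ [] , complete) =
    (T , v) , λ v₁ v₂ → trans (the (complete _ v₁)) (sym (the (complete _ v₂)))
    where
    the : ∀ {T′} → T′ ∈ [ T ] → T′ ≡ T
    the (here e) = e

  twoFoldable-intro : ∀ {w : W} {P Q} → Valid P w → Valid Q w → P ≢ Q →
                      (∀ T → Valid T w → T ≡ P ⊎ T ≡ Q) → KFoldable 2 w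
  twoFoldable-intro {P = P} {Q} vp vq P≢Q complete =
    P ∷ Q ∷ [] , refl , (P≢Q ∷ []) ∷ [] ∷ [] , vp ∷ vq ∷ [] , λ T v → [ here , there ∘ here ]′ (complete T v)

  twoFoldable-elim : ∀ {w : W} → KFoldable 2 w →
                     ∃ λ P → ∃ λ Q → Valid P w × Valid Q w × P ≢ Q × (∀ T → Valid T w → T ≡ P ⊎ T ≡ Q)
  twoFoldable-elim ((P ∷ Q ∷ []) , refl , (P≢Q ∷ []) ∷ _ , vp ∷ vq ∷ [] , complete) =
    P , Q , vp , vq , P≢Q , λ T v → one-of (complete T v)
    where
    one-of : ∀ {T} → T ∈ P ∷ Q ∷ [] → T ≡ P ⊎ T ≡ Q
    one-of (here e) = inj₁ e
    one-of (there (here e)) = inj₂ e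

  twoFoldable-pigeonhole : ∀ {w : W} {X X′ Y} → KFoldable 2 w → Valid X w → Valid X′ w → Valid Y w →
                           Y ≢ X → Y ≢ X′ → X ≡ X′
  twoFoldable-pigeonhole {X = X} {X′} {Y} k vx vx′ vy Y≢X Y≢X′ with twoFoldable-elim k
  ... | _ , _ , _ , _ , _ , only with only X vx | only X′ vx′ | only Y vy
  ... | inj₁ refl | inj₁ refl | _ = refl
  ... | inj₂ refl | inj₂ refl | _ = refl
  ... | inj₁ refl | inj₂ refl | inj₁ refl = ⊥-elim (Y≢X refl)
  ... | inj₁ refl | inj₂ refl | inj₂ refl = ⊥-elim (Y≢X′ refl)
  ... | inj₂ refl | inj₁ refl | inj₁ refl = ⊥-elim (Y≢X′ refl)
  ... | inj₂ refl | inj₁ refl | inj₂ refl = ⊥-elim (Y≢X refl)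

  children : PlaneTree → List PlaneTree
  children (node ts) = ts

  -- At most two crossings per edge force the tree

  crossings-arc : ∀ E a u v {r} → Reduced r → u ⋆ comp a ∙ r ≡ comp a ∙ r → v ⋆ r ≡ r →
                  crossings E (a ∷ u ++ comp a ∷ v) r ≡
                    hits E (edge (comp a) r) +
                      (crossings E u (comp a ∙ r) + (hits E (edge (comp a) r) + crossings E v r))
  crossings-arc E a u v {r} rr hu hv
    rewrite ⋆-++ u (comp a ∷ v) r | crossings-++ E u (comp a ∷ v) r | hv | hu | edge-∙-comp a rr = refl

  ⋆-∷-closed : ∀ x s rest {b b′} → rest ⋆ b ≡ b′ → s ⋆ b′ ≡ b′ → (x ∷ s ++ rest) ⋆ b ≡ x ∙ b′
  ⋆-∷-closed x s rest {b} hr hs = cong (x ∙_) (trans (⋆-++ s rest b) (trans (cong (s ⋆_) hr) hs))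

  crossings-∷-closed : ∀ E x s rest {b b′} → rest ⋆ b ≡ b′ → s ⋆ b′ ≡ b′ →
                       crossings E (x ∷ s ++ rest) b ≡
                         hits E (edge x b′) + (crossings E s b′ + crossings E rest b)
  crossings-∷-closed E x s rest {b} hr hs rewrite ⋆-++ s rest b | crossings-++ E s rest b | hr | hs = refl

  step-crossing : ∀ E p c v {r} → edge c (v ⋆ r) ≡ E → 1 ≤ crossings E (p ++ c ∷ v) r
  step-crossing E p c v {r} e rewrite crossings-++ E p (c ∷ v) r | hits-≡ e =
    ℕ.≤-trans (s≤s z≤n) (ℕ.m≤n+m (suc (crossings E v r)) (crossings E p (c ∙ v ⋆ r)))

  avoids-step : ∀ {E s b} p c q → crossings E s b ≡ 0 → s ≡ p ++ c ∷ q → edge c (q ⋆ b) ≡ E → ⊥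
  avoids-step p c q avoid refl e with () ← subst (1 ≤_) avoid (step-crossing _ p c q e)

  later-closing⇒three-crossings : ∀ a u v mid v′ {r} → Reduced r →
    u ⋆ comp a ∙ r ≡ comp a ∙ r → v ⋆ r ≡ r → v ≡ mid ++ comp a ∷ v′ → v′ ⋆ r ≡ r →
    3 ≤ crossings (edge (comp a) r) (a ∷ u ++ comp a ∷ v) r
  later-closing⇒three-crossings a u v mid v′ {r} rr hu hv refl hv′
    rewrite crossings-arc (edge (comp a) r) a u (mid ++ comp a ∷ v′) rr hu hv
          | hits-≡ {edge (comp a) r} refl =
    s≤s (ℕ.≤-trans (s≤s (step-crossing _ mid (comp a) v′ (cong (edge (comp a)) hv′)))
                   (ℕ.m≤n+m _ (crossings (edge (comp a) r) u (comp a ∙ r))))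

  crossings-arc-pieces : ∀ E a u v {r} → Reduced r → u ⋆ comp a ∙ r ≡ comp a ∙ r → v ⋆ r ≡ r →
    crossings E u (comp a ∙ r) ≤ crossings E (a ∷ u ++ comp a ∷ v) r ×
    crossings E v r ≤ crossings E (a ∷ u ++ comp a ∷ v) r
  crossings-arc-pieces E a u v {r} rr hu hv rewrite crossings-arc E a u v rr hu hv =
    let i = hits E (edge (comp a) r) in
    ℕ.≤-trans (ℕ.m≤m+n _ (i + crossings E v r)) (ℕ.m≤n+m _ i) ,
    ℕ.≤-trans (ℕ.m≤n+m _ i) (ℕ.≤-trans (ℕ.m≤n+m _ (crossings E u (comp a ∙ r))) (ℕ.m≤n+m _ i))

  crossings≤2⇒unique : ∀ ts ts′ {w r} → Reduced r → (∀ E → crossings E w r ≤ 2) →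
                       ValidF {m} ts w → ValidF {m} ts′ w → ts ≡ ts′
  crossings≤2⇒unique [] [] rr bound refl refl = refl
  crossings≤2⇒unique [] (node _ ∷ _) rr bound refl (_ , _ , _ , () , _)
  crossings≤2⇒unique (node _ ∷ _) [] rr bound (_ , _ , _ , refl , _) ()
  crossings≤2⇒unique (node us ∷ ts) (node us′ ∷ ts′) {r = r} rr bound
                     (a , u , v , refl , vu , vv) (_ , u′ , v′ , e , vu′ , vv′)
    with refl , e′ ← List.∷-injective e with compareSplits u (comp a) v u′ (comp a) v′ e′
  ... | same refl _ refl =
    cong₂ (λ p q → node p ∷ q)
      (crossings≤2⇒unique us us′ (∙-reduced (comp a) rr)
        (λ E → ℕ.≤-trans (proj₁ (crossings-arc-pieces E a u v rr cu cv)) (bound E)) vu vu′)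
      (crossings≤2⇒unique ts ts′ rr
        (λ E → ℕ.≤-trans (proj₂ (crossings-arc-pieces E a u v rr cu cv)) (bound E)) vv vv′)
    where
    cu : u ⋆ comp a ∙ r ≡ comp a ∙ r
    cu = ValidF-closed us vu (∙-reduced (comp a) rr)
    cv : v ⋆ r ≡ r
    cv = ValidF-closed ts vv rr
  ... | before mid refl v≡ =
    ⊥-elim (ℕ.≤⇒≯ (bound (edge (comp a) r)) (later-closing⇒three-crossings a u v mid v′ rr
      (ValidF-closed us vu (∙-reduced (comp a) rr)) (ValidF-closed ts vv rr) v≡ (ValidF-closed ts′ vv′ rr)))
  ... | after mid refl v′≡ =
    ⊥-elim (ℕ.≤⇒≯ (bound (edge (comp a) r)) (subst (λ w → 3 ≤ crossings (edge (comp a) r) w r) (sym e)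
      (later-closing⇒three-crossings a u′ v′ mid v rr
        (ValidF-closed us′ vu′ (∙-reduced (comp a) rr)) (ValidF-closed ts′ vv′ rr) v′≡ (ValidF-closed ts vv rr))))

  crossedEdges : W → W → List W
  crossedEdges [] r = []
  crossedEdges (x ∷ w) r = edge x (w ⋆ r) ∷ crossedEdges w r

  crossed⇒∈crossedEdges : ∀ E w r → 1 ≤ crossings E w r → E ∈ crossedEdges w r
  crossed⇒∈crossedEdges E (x ∷ w) r h with edge x (w ⋆ r) ≟ᵂ E
  ... | yes e = here (sym e)
  ... | no _ = there (crossed⇒∈crossedEdges E w r h)

  crossings≤2? : ∀ w r → (∀ E → crossings E w r ≤ 2) ⊎ (∃ λ E → 3 ≤ crossings E w r)
  crossings≤2? w r with All.all? (λ E → crossings E w r ≤? 2) (crossedEdges w r)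
  ... | no ¬all =
    let E , ≰2 = Any.satisfied (Allₚ.¬All⇒Any¬ (λ E → crossings E w r ≤? 2) _ ¬all) in inj₂ (E , ℕ.≰⇒> ≰2)
  ... | yes all≤2 = inj₁ λ E → case crossings E w r ≤? 2 of λ where
    (yes ≤2) → ≤2
    (no ≰2) → All.lookup all≤2 (crossed⇒∈crossedEdges E w r (ℕ.≤-trans (s≤s z≤n) (ℕ.≰⇒> ≰2)))

  -- An edge crossed four times

  lastCrossing : ∀ E w b → 1 ≤ crossings E w b →
    ∃ λ p → ∃ λ x → ∃ λ s → w ≡ p ++ x ∷ s × crossings E s b ≡ 0 × edge x (s ⋆ b) ≡ E ×
      crossings E w b ≡ suc (crossings E p (x ∙ s ⋆ b))
  lastCrossing E (y ∷ w) b h with crossings E w b in eq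
  ... | suc n
    with p , x , s , refl , avoid , crosses , count ← lastCrossing E w b (subst (1 ≤_) (sym eq) (s≤s z≤n)) =
    y ∷ p , x , s , refl , avoid , crosses ,
    trans (cong (hits E (edge y ((p ++ x ∷ s) ⋆ b)) +_) (trans (sym eq) count))
      (trans (ℕ.+-suc _ _) (cong (λ z → suc (hits E (edge y z) + crossings E p (x ∙ s ⋆ b))) (⋆-++ p (x ∷ s) b)))
  ... | zero with edge y (w ⋆ b) ≟ᵂ E
  ...   | yes crosses = [] , y , w , refl , eq , crosses , refl
  lastCrossing E (y ∷ w) b () | zero | no _

  -- The excursion s after the last crossing avoids E, so that crossing starts on v's side: it is x at v.
  previousCrossing : ∀ E x v t p → Reduced v → edge x v ≡ E → x ∙ v ≡ t → 1 ≤ crossings E p v →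
    ∃ λ p′ → ∃ λ s → p ≡ p′ ++ x ∷ s × s ⋆ v ≡ v × p ⋆ v ≡ p′ ⋆ t ×
      crossings E p v ≡ suc (crossings E p′ t)
  previousCrossing E x v t p rv ex xv≡t h
    with p′ , y , s , refl , avoid , ey , count ← lastCrossing E p v h
    with refl , v≡s⋆v ← crossing-from-same-side x v y (s ⋆ v) ex ey (sym (beyond-⋆-uncrossed E s avoid)) =
    p′ , s , refl , sym v≡s⋆v , trans (⋆-++ p′ (x ∷ s) v) (cong (p′ ⋆_) step) ,
    trans count (cong (suc ∘ crossings E p′) step)
    where
    step : x ∙ s ⋆ v ≡ t
    step = trans (cong (x ∙_) (sym v≡s⋆v)) xv≡t

  twoArcs : L → W → W → W → W → W
  twoArcs A v₁ u₂ v₂ u = A ∷ v₁ ++ comp A ∷ u₂ ++ A ∷ v₂ ++ comp A ∷ u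

  shortArcRest : L → W → W → W → W
  shortArcRest A u₂ v₂ u = u₂ ++ A ∷ v₂ ++ comp A ∷ u

  longArcInside : L → W → W → W → W
  longArcInside A v₁ u₂ v₂ = v₁ ++ comp A ∷ u₂ ++ A ∷ v₂

  outerWord : L → W → W → W
  outerWord A u₂ u = u₂ ++ A ∷ comp A ∷ u

  innerWord : L → W → W → W
  innerWord A v₁ v₂ = A ∷ v₁ ++ v₂ ++ [ comp A ]

  twoArcs-long : ∀ A v₁ u₂ v₂ u → twoArcs A v₁ u₂ v₂ u ≡ A ∷ longArcInside A v₁ u₂ v₂ ++ comp A ∷ u
  twoArcs-long A v₁ u₂ v₂ u = cong (A ∷_) (sym (trans (List.++-assoc v₁ _ (comp A ∷ u))
    (cong (λ z → v₁ ++ comp A ∷ z) (List.++-assoc u₂ (A ∷ v₂) (comp A ∷ u)))))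

  twoArcs-++ : ∀ A v₁ u₂ v₂ u q → twoArcs A v₁ u₂ v₂ u ++ q ≡ twoArcs A v₁ u₂ v₂ (u ++ q)
  twoArcs-++ A v₁ u₂ v₂ u q =
    cong (A ∷_) (trans (List.++-assoc v₁ _ q) (cong (λ z → v₁ ++ comp A ∷ z)
      (trans (List.++-assoc u₂ _ q) (cong (λ z → u₂ ++ A ∷ z) (List.++-assoc v₂ _ q)))))

  twoArcs-rotation : ∀ A u₁ v₁ u₂ v₂ u₃ →
    (u₁ ++ A ∷ v₁ ++ comp A ∷ u₂ ++ A ∷ v₂ ++ comp A ∷ u₃) ≅ twoArcs A v₁ u₂ v₂ (u₃ ++ u₁)
  twoArcs-rotation A u₁ v₁ u₂ v₂ u₃ = ≅-trans (++-comm-≅ u₁ _) (≡⇒≅ (twoArcs-++ A v₁ u₂ v₂ u₃ u₁))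

  record ArcsClosed (A : L) (v₁ u₂ v₂ u N : W) : Set where
    field
      N-reduced : Reduced N
      v₁-closed : v₁ ⋆ comp A ∙ N ≡ comp A ∙ N
      u₂-closed : u₂ ⋆ N ≡ N
      v₂-closed : v₂ ⋆ comp A ∙ N ≡ comp A ∙ N
      u-closed : u ⋆ N ≡ N

  record Decomposition (w : W) : Set where
    field
      A : L
      u₁ v₁ u₂ v₂ u₃ N : W
      split : w ≡ u₁ ++ A ∷ v₁ ++ comp A ∷ u₂ ++ A ∷ v₂ ++ comp A ∷ u₃
      closed : ArcsClosed A v₁ u₂ v₂ (u₃ ++ u₁) N

    rotation : w ≅ twoArcs A v₁ u₂ v₂ (u₃ ++ u₁)
    rotation = ≅-trans (≡⇒≅ split) (twoArcs-rotation A u₁ v₁ u₂ v₂ u₃)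

  threeMoreCrossings : ∀ E A N p → Reduced N → edge (comp A) N ≡ E → 3 ≤ crossings E p (comp A ∙ N) →
    ∃ λ u₁ → ∃ λ v₁ → ∃ λ u₂ → ∃ λ v₂ → p ≡ u₁ ++ A ∷ v₁ ++ comp A ∷ u₂ ++ A ∷ v₂ ×
      v₁ ⋆ comp A ∙ N ≡ comp A ∙ N × u₂ ⋆ N ≡ N × v₂ ⋆ comp A ∙ N ≡ comp A ∙ N × p ⋆ comp A ∙ N ≡ u₁ ⋆ N
  threeMoreCrossings E A N p rN eN h3
    with p₃ , v₂ , refl , cv₂ , arrive₃ , count₃
           ← previousCrossing E A (comp A ∙ N) N p (∙-reduced (comp A) rN) (trans (edge-∙-comp A rN) eN)
               (∙-inverseˡ A rN) (ℕ.≤-trans (s≤s z≤n) h3)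
    with p₂ , u₂ , refl , cu₂ , arrive₂ , count₂
           ← previousCrossing E (comp A) N (comp A ∙ N) p₃ rN eN refl
               (ℕ.≤-trans (s≤s z≤n) (s≤s⁻¹ (subst (3 ≤_) count₃ h3)))
    with u₁ , v₁ , refl , cv₁ , arrive₁ , _
           ← previousCrossing E A (comp A ∙ N) N p₂ (∙-reduced (comp A) rN) (trans (edge-∙-comp A rN) eN)
               (∙-inverseˡ A rN) (s≤s⁻¹ (subst (2 ≤_) count₂ (s≤s⁻¹ (subst (3 ≤_) count₃ h3))))
    = u₁ , v₁ , u₂ , v₂ , assoc , cv₁ , cu₂ , cv₂ , trans arrive₃ (trans arrive₂ arrive₁)
    where
    assoc : ((u₁ ++ A ∷ v₁) ++ comp A ∷ u₂) ++ A ∷ v₂ ≡ u₁ ++ A ∷ v₁ ++ comp A ∷ u₂ ++ A ∷ v₂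
    assoc = trans (List.++-assoc (u₁ ++ A ∷ v₁) (comp A ∷ u₂) (A ∷ v₂))
                  (List.++-assoc u₁ (A ∷ v₁) (comp A ∷ u₂ ++ A ∷ v₂))

  crossings≥3⇒decomposition : ∀ E w {r} → Reduced r → w ⋆ r ≡ r → 3 ≤ crossings E w r → Decomposition w
  crossings≥3⇒decomposition E w {r} rr closed h3
    with p , X , u₃ , refl , _ , eN , count ← lastCrossing E w r (ℕ.≤-trans (s≤s z≤n) h3)
    with A , refl ← comp-surjective X
    with u₁ , v₁ , u₂ , v₂ , refl , cv₁ , cu₂ , cv₂ , arrive
           ← threeMoreCrossings E A (u₃ ⋆ r) p (⋆-reduced u₃ rr) eN
               (s≤s⁻¹ (subst (4 ≤_) count (ℕ.≤∧≢⇒< h3 (≢-sym (closed⇒crossings≢3 E w closed)))))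
    = record
      { A = A ; u₁ = u₁ ; v₁ = v₁ ; u₂ = u₂ ; v₂ = v₂ ; u₃ = u₃ ; N = u₃ ⋆ r
      ; split = trans (List.++-assoc u₁ _ (comp A ∷ u₃)) (cong (λ z → u₁ ++ A ∷ z)
                  (trans (List.++-assoc v₁ _ (comp A ∷ u₃)) (cong (λ z → v₁ ++ comp A ∷ z)
                    (List.++-assoc u₂ (A ∷ v₂) (comp A ∷ u₃)))))
      ; closed = record
        { N-reduced = ⋆-reduced u₃ rr ; v₁-closed = cv₁ ; u₂-closed = cu₂ ; v₂-closed = cv₂
        ; u-closed = trans (⋆-++ u₃ u₁ (u₃ ⋆ r)) (cong (u₃ ⋆_) u₁-arrives) } }
    where
    u₁-arrives : u₁ ⋆ u₃ ⋆ r ≡ r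
    u₁-arrives =
      trans (sym arrive) (trans (sym (⋆-++ (u₁ ++ A ∷ v₁ ++ comp A ∷ u₂ ++ A ∷ v₂) (comp A ∷ u₃) r)) closed)

  -- The two trees of a double arc

  tree₁ tree₂ : (f₁ f₂ g₂ h : List PlaneTree) → PlaneTree
  tree₁ f₁ f₂ g₂ h = node (node f₁ ∷ f₂ ++ node g₂ ∷ h)
  tree₂ f₁ f₂ g₂ h = node (node (f₁ ++ node f₂ ∷ g₂) ∷ h)

  shortArcRest-valid : ∀ A {u₂ v₂ u f₂ g₂ h} → ValidF {m} f₂ u₂ → ValidF g₂ v₂ → ValidF h u →
                       ValidF (f₂ ++ node g₂ ∷ h) (shortArcRest A u₂ v₂ u)
  shortArcRest-valid A {f₂ = f₂} {g₂} {h} vf₂ vg₂ vh =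
    ValidF-++ f₂ (node g₂ ∷ h) vf₂ (A , _ , _ , refl , vg₂ , vh)

  longArcInside-valid : ∀ A {v₁ u₂ v₂ f₁ f₂ g₂} → ValidF {m} f₁ v₁ → ValidF f₂ u₂ → ValidF g₂ v₂ →
                        ValidF (f₁ ++ node f₂ ∷ g₂) (longArcInside A v₁ u₂ v₂)
  longArcInside-valid A {u₂ = u₂} {v₂} {f₁} {f₂} {g₂} vf₁ vf₂ vg₂ =
    ValidF-++ f₁ (node f₂ ∷ g₂) vf₁
      (comp A , u₂ , v₂ , cong (λ z → comp A ∷ u₂ ++ z ∷ v₂) (sym (comp-involutive A)) , vf₂ , vg₂)

  module _ (A : L) {v₁ u₂ v₂ u : W} {f₁ f₂ g₂ h : List PlaneTree}
           (vf₁ : ValidF f₁ v₁) (vf₂ : ValidF f₂ u₂) (vg₂ : ValidF g₂ v₂) (vh : ValidF h u) where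

    tree₁-valid : Valid (tree₁ f₁ f₂ g₂ h) (twoArcs A v₁ u₂ v₂ u)
    tree₁-valid = A , v₁ , shortArcRest A u₂ v₂ u , refl , vf₁ , shortArcRest-valid A vf₂ vg₂ vh

    tree₂-valid : Valid (tree₂ f₁ f₂ g₂ h) (twoArcs A v₁ u₂ v₂ u)
    tree₂-valid =
      A , longArcInside A v₁ u₂ v₂ , u , twoArcs-long A v₁ u₂ v₂ u , longArcInside-valid A vf₁ vf₂ vg₂ , vh

  firstSubtrees-differ : ∀ {a b : W} us us′ ts ts′ → ValidF us a → ValidF us′ b → length a ≢ length b →
                         node (node us ∷ ts) ≢ node (node us′ ∷ ts′)
  firstSubtrees-differ us _ _ _ va vb ne refl = ne (ValidF-length us va vb)

  longArcInside-longer : ∀ A (v₁ u₂ v₂ : W) → length v₁ < length (longArcInside A v₁ u₂ v₂)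
  longArcInside-longer A v₁ u₂ v₂ =
    subst (length v₁ <_) (sym (List.length-++ v₁)) (ℕ.m<m+n (length v₁) (s≤s z≤n))

  tree₁≢tree₂ : ∀ A {v₁ u₂ v₂ f₁ f₂ g₂} h → ValidF {m} f₁ v₁ → ValidF f₂ u₂ → ValidF g₂ v₂ →
                tree₁ f₁ f₂ g₂ h ≢ tree₂ f₁ f₂ g₂ h
  tree₁≢tree₂ A {v₁} {u₂} {v₂} h vf₁ vf₂ vg₂ =
    firstSubtrees-differ _ _ _ h vf₁ (longArcInside-valid A vf₁ vf₂ vg₂)
      (ℕ.<⇒≢ (longArcInside-longer A v₁ u₂ v₂))

  arcForests : ∀ {A v₁ u₂ v₂ u N} → ArcsClosed A v₁ u₂ v₂ u N → Forest v₁ × Forest u₂ × Forest v₂ × Forest u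
  arcForests {A} {N = N} S = closed⇒forest _ F-reduced v₁-closed , closed⇒forest _ N-reduced u₂-closed ,
                             closed⇒forest _ F-reduced v₂-closed , closed⇒forest _ N-reduced u-closed
    where
    open ArcsClosed S
    F-reduced : Reduced (comp A ∙ N)
    F-reduced = ∙-reduced (comp A) N-reduced

  decomposition⇒¬atMostOneTree : ∀ {w} → Decomposition w → ¬ AtMostOneTree w
  decomposition⇒¬atMostOneTree D unique with arcForests (Decomposition.closed D)
  ... | (f₁ , vf₁) , (f₂ , vf₂) , (g₂ , vg₂) , (h , vh) =
    tree₁≢tree₂ A h vf₁ vf₂ vg₂
      (≅-atMostOneTree rotation unique (tree₁-valid A vf₁ vf₂ vg₂ vh) (tree₂-valid A vf₁ vf₂ vg₂ vh))
    where open Decomposition D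

  atMostOneTree⇒crossings≤2 : ∀ w {r} → Reduced r → w ⋆ r ≡ r → AtMostOneTree w → ∀ E → crossings E w r ≤ 2
  atMostOneTree⇒crossings≤2 w {r} rr closed unique E with crossings E w r ≤? 2
  ... | yes ≤2 = ≤2
  ... | no ≰2 =
    ⊥-elim (decomposition⇒¬atMostOneTree (crossings≥3⇒decomposition E w rr closed (ℕ.≰⇒> ≰2)) unique)

  oneFoldable⇔crossings≤2 : ∀ {w r} → Forest w → Reduced r → KFoldable 1 w ⇔ (∀ E → crossings E w r ≤ 2)
  oneFoldable⇔crossings≤2 {w} (ts , vt) rr = mk⇔
    (λ one → atMostOneTree⇒crossings≤2 w rr (ValidF-closed ts vt rr) (proj₂ (oneFoldable-elim one)))
    (λ bound → oneFoldable-intro {T = node ts} vt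
      λ { (node ts′) vt′ → cong node (crossings≤2⇒unique ts′ ts rr bound vt′ vt) })

  -- Read from N, every arc letter of twoArcs A v₁ u₂ v₂ u crosses the edge E₀.
  module Arcs {A : L} {v₁ u₂ v₂ u N : W} (S : ArcsClosed A v₁ u₂ v₂ u N) where
    open ArcsClosed S

    F : W
    F = comp A ∙ N

    E₀ : W
    E₀ = edge (comp A) N

    F-reduced : Reduced F
    F-reduced = ∙-reduced (comp A) N-reduced

    edge-A-F : edge A F ≡ E₀
    edge-A-F = edge-∙-comp A N-reduced

    A∙F : A ∙ F ≡ N
    A∙F = ∙-inverseˡ A N-reduced

    i a b c d : W → ℕ
    i E = hits E E₀
    a E = crossings E v₁ F
    b E = crossings E u₂ N
    c E = crossings E v₂ F
    d E = crossings E u N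

    ⋆-shortArcTail : (A ∷ v₂ ++ comp A ∷ u) ⋆ N ≡ N
    ⋆-shortArcTail = trans (⋆-∷-closed A v₂ (comp A ∷ u) (cong (comp A ∙_) u-closed) v₂-closed) A∙F

    ⋆-shortArcRest : shortArcRest A u₂ v₂ u ⋆ N ≡ N
    ⋆-shortArcRest = trans (⋆-++ u₂ _ N) (trans (cong (u₂ ⋆_) ⋆-shortArcTail) u₂-closed)

    crossings-shortArcRest : ∀ E → crossings E (shortArcRest A u₂ v₂ u) N ≡ b E + (i E + (c E + (i E + d E)))
    crossings-shortArcRest E
      rewrite crossings-++ E u₂ (A ∷ v₂ ++ comp A ∷ u) N | ⋆-shortArcTail
            | crossings-arc E A v₂ u N-reduced v₂-closed u-closed = refl

    ⋆-A∷v₂ : (A ∷ v₂) ⋆ F ≡ N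
    ⋆-A∷v₂ = trans (cong (A ∙_) v₂-closed) A∙F

    crossings-longArcInside : ∀ E → crossings E (longArcInside A v₁ u₂ v₂) F ≡ a E + (i E + (b E + (i E + c E)))
    crossings-longArcInside E
      rewrite crossings-++ E v₁ (comp A ∷ u₂ ++ A ∷ v₂) F | ⋆-∷-closed (comp A) u₂ (A ∷ v₂) ⋆-A∷v₂ u₂-closed
            | crossings-∷-closed E (comp A) u₂ (A ∷ v₂) ⋆-A∷v₂ u₂-closed | v₂-closed | edge-A-F = refl

    crossings-outer : ∀ E → crossings E (outerWord A u₂ u) N ≡ b E + (i E + (i E + d E))
    crossings-outer E rewrite crossings-++ E u₂ (A ∷ comp A ∷ u) N | u-closed | edge-A-F | A∙F = refl

    crossings-inner : ∀ E → crossings E (innerWord A v₁ v₂) N ≡ a E + (i E + (i E + c E))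
    crossings-inner E
      rewrite ⋆-++ v₁ (v₂ ++ [ comp A ]) N | crossings-++ E v₁ (v₂ ++ [ comp A ]) N
            | ⋆-++ v₂ [ comp A ] N | crossings-++ E v₂ [ comp A ] N | v₂-closed | v₁-closed | edge-A-F =
      rearrange (i E) (a E) (c E)
      where
      rearrange : ∀ i a c → i + (a + (c + (i + 0))) ≡ a + (i + (i + c))
      rearrange = solve-∀

    -- The edges crossed by v₁, v₂ lie on the side of E₀ containing F, those crossed by u₂, u
    -- on the side containing N.
    v-or-u-avoids : a E₀ ≡ 0 → b E₀ ≡ 0 → c E₀ ≡ 0 → d E₀ ≡ 0 → ∀ E → a E + c E ≡ 0 ⊎ b E + d E ≡ 0
    v-or-u-avoids a₀ b₀ c₀ d₀ E with m+n≡0⊎1≤m⊎1≤n (a E) (c E) | m+n≡0⊎1≤m⊎1≤n (b E) (d E)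
    ... | inj₁ e | _ = inj₁ e
    ... | inj₂ _ | inj₁ e = inj₂ e
    ... | inj₂ v-crosses | inj₂ u-crosses =
      ⊥-elim (Bool.not-¬ refl (trans (sym side-N) (trans side-F (beyond-∙-crossing (comp A) N refl))))
      where
      side-F : beyond E₀ E ≡ beyond E₀ F
      side-F = [ beyond-crossed-edge E₀ E v₁ a₀ , beyond-crossed-edge E₀ E v₂ c₀ ]′ v-crosses
      side-N : beyond E₀ E ≡ beyond E₀ N
      side-N = [ beyond-crossed-edge E₀ E u₂ b₀ , beyond-crossed-edge E₀ E u d₀ ]′ u-crosses

    module _ (outer≤2 : ∀ E → crossings E (outerWord A u₂ u) N ≤ 2)
             (inner≤2 : ∀ E → crossings E (innerWord A v₁ v₂) N ≤ 2) where

      private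
        i₀ : i E₀ ≡ 1
        i₀ = hits-≡ {E₀} refl

        outer₀ : b E₀ ≡ 0 × d E₀ ≡ 0
        outer₀ = m+2+n≤2⇒m≡n≡0 (b E₀) (d E₀)
          (subst (_≤ 2) (trans (crossings-outer E₀) (cong (λ k → b E₀ + (k + (k + d E₀))) i₀)) (outer≤2 E₀))

        inner₀ : a E₀ ≡ 0 × c E₀ ≡ 0
        inner₀ = m+2+n≤2⇒m≡n≡0 (a E₀) (c E₀)
          (subst (_≤ 2) (trans (crossings-inner E₀) (cong (λ k → a E₀ + (k + (k + c E₀))) i₀)) (inner≤2 E₀))

        a≤2 : ∀ E → a E ≤ 2
        a≤2 E = ℕ.≤-trans (ℕ.m≤m+n (a E) _) (subst (_≤ 2) (crossings-inner E) (inner≤2 E))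

        d≤2 : ∀ E → d E ≤ 2
        d≤2 E = ℕ.≤-trans (ℕ.m≤n+m (d E) (i E)) (ℕ.≤-trans (ℕ.m≤n+m _ (i E)) (ℕ.≤-trans (ℕ.m≤n+m _ (b E))
                  (subst (_≤ 2) (crossings-outer E) (outer≤2 E))))

        arcs≤2 : ∀ E → crossings E (shortArcRest A u₂ v₂ u) N ≤ 2 × crossings E (longArcInside A v₁ u₂ v₂) F ≤ 2
        arcs≤2 E =
          let rest≤2 , inside≤2 = arcBounds (i E) (a E) (b E) (c E) (d E)
                (subst (_≤ 2) (crossings-outer E) (outer≤2 E)) (subst (_≤ 2) (crossings-inner E) (inner≤2 E))
                (v-or-u-avoids (proj₁ inner₀) (proj₁ outer₀) (proj₂ inner₀) (proj₂ outer₀) E)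
          in subst (_≤ 2) (sym (crossings-shortArcRest E)) rest≤2 ,
             subst (_≤ 2) (sym (crossings-longArcInside E)) inside≤2

        -- The first arc of a tree for twoArcs closes beyond v₁: at the second Ā, or at a
        -- letter Ā inside u₂, v₂ or u, which cannot cross E₀.
        closing-after-v₁ : ∀ {f₁ f₂ g₂ h us ts} mid y → ValidF f₁ v₁ → ValidF f₂ u₂ → ValidF g₂ v₂ → ValidF h u →
          ValidF us (v₁ ++ comp A ∷ mid) → ValidF ts y → shortArcRest A u₂ v₂ u ≡ mid ++ comp A ∷ y →
          node (node us ∷ ts) ≡ tree₂ f₁ f₂ g₂ h
        closing-after-v₁ {us = us} {ts} mid y vf₁ vf₂ vg₂ vh vx vy rest≡
          with y-closed ← ValidF-closed ts vy N-reduced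
          with compareSplits mid (comp A) y u₂ A (v₂ ++ comp A ∷ u) (sym rest≡)
        ... | same _ Ā≡A _ = ⊥-elim (comp≢self A Ā≡A)
        ... | before mm u₂≡ refl = ⊥-elim (avoids-step mid (comp A) mm (proj₁ outer₀) u₂≡
                                     (cong (edge (comp A)) (⋆-++-prefix mm _ y-closed ⋆-shortArcTail)))
        ... | after mm refl tail≡ with compareSplits mm (comp A) y v₂ (comp A) u (sym tail≡)
        ...   | same refl _ refl =
          cong₂ (λ p q → node (node p ∷ q))
            (crossings≤2⇒unique us _ F-reduced (proj₂ ∘ arcs≤2) vx (longArcInside-valid A vf₁ vf₂ vg₂))
            (crossings≤2⇒unique ts _ N-reduced d≤2 vy vh)
        ...   | before mm₃ v₂≡ refl = ⊥-elim (avoids-step mm (comp A) mm₃ (proj₂ inner₀) v₂≡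
                                         (cong (edge (comp A)) (⋆-++-prefix mm₃ _ y-closed (cong (comp A ∙_) u-closed))))
        ...   | after mm₃ refl u≡ =
          ⊥-elim (avoids-step mm₃ (comp A) y (proj₂ outer₀) u≡ (cong (edge (comp A)) y-closed))

      twoArcs-trees : ∀ {f₁ f₂ g₂ h} → ValidF f₁ v₁ → ValidF f₂ u₂ → ValidF g₂ v₂ → ValidF h u →
                      ∀ T → Valid T (twoArcs A v₁ u₂ v₂ u) → T ≡ tree₁ f₁ f₂ g₂ h ⊎ T ≡ tree₂ f₁ f₂ g₂ h
      twoArcs-trees vf₁ vf₂ vg₂ vh (node (node us ∷ ts)) (_ , x , y , eq , vx , vy)
        with refl , eq′ ← List.∷-injective eq
        with compareSplits x (comp A) y v₁ (comp A) (shortArcRest A u₂ v₂ u) (sym eq′)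
      ... | same refl _ refl =
        inj₁ (cong₂ (λ p q → node (node p ∷ q))
               (crossings≤2⇒unique us _ F-reduced a≤2 vx vf₁)
               (crossings≤2⇒unique ts _ N-reduced (proj₁ ∘ arcs≤2) vy (shortArcRest-valid A vf₂ vg₂ vh)))
      ... | before mid v₁≡ refl =
        ⊥-elim (avoids-step x (comp A) mid (proj₁ inner₀) v₁≡
          (cong (edge (comp A))
            (⋆-++-prefix mid _ (ValidF-closed ts vy N-reduced) (cong (comp A ∙_) ⋆-shortArcRest))))
      ... | after mid refl rest≡ = inj₂ (closing-after-v₁ mid y vf₁ vf₂ vg₂ vh vx vy rest≡)

      twoArcs-twoFoldable : KFoldable 2 (twoArcs A v₁ u₂ v₂ u)
      twoArcs-twoFoldable with arcForests S
      ... | (f₁ , vf₁) , (f₂ , vf₂) , (g₂ , vg₂) , (h , vh) =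
        twoFoldable-intro (tree₁-valid A vf₁ vf₂ vg₂ vh) (tree₂-valid A vf₁ vf₂ vg₂ vh)
          (tree₁≢tree₂ A h vf₁ vf₂ vg₂) (twoArcs-trees vf₁ vf₂ vg₂ vh)

    twoArcs-twoFoldable⁻ : KFoldable 2 (twoArcs A v₁ u₂ v₂ u) →
                           (∀ E → crossings E (outerWord A u₂ u) N ≤ 2) ×
                           (∀ E → crossings E (innerWord A v₁ v₂) N ≤ 2)
    twoArcs-twoFoldable⁻ two with arcForests S
    ... | (f₁ , vf₁) , (f₂ , vf₂) , (g₂ , vg₂) , (h , vh) =
      (λ E → ℕ.≤-trans (outer≤rest E) (rest≤2 E)) , (λ E → ℕ.≤-trans (inner≤inside E) (inside≤2 E))
      where
      tree₂-first-longer : ∀ {ts} → ValidF ts v₁ → ∀ ts′ → tree₂ f₁ f₂ g₂ h ≢ node (node ts ∷ ts′)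
      tree₂-first-longer vt ts′ = firstSubtrees-differ _ _ h ts′ (longArcInside-valid A vf₁ vf₂ vg₂) vt
                                    (ℕ.>⇒≢ (longArcInside-longer A v₁ u₂ v₂))

      tree₁-first-shorter : ∀ {ts} → ValidF ts (longArcInside A v₁ u₂ v₂) → tree₁ f₁ f₂ g₂ h ≢ node (node ts ∷ h)
      tree₁-first-shorter vt = firstSubtrees-differ f₁ _ _ h vf₁ vt (ℕ.<⇒≢ (longArcInside-longer A v₁ u₂ v₂))

      rest-unique : AtMostOneTree (shortArcRest A u₂ v₂ u)
      rest-unique {node ts} {node ts′} vt vt′ =
        cong node (List.∷-injectiveʳ (cong children (twoFoldable-pigeonhole two
          (A , v₁ , _ , refl , vf₁ , vt) (A , v₁ , _ , refl , vf₁ , vt′) (tree₂-valid A vf₁ vf₂ vg₂ vh)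
          (tree₂-first-longer vf₁ ts) (tree₂-first-longer vf₁ ts′))))

      inside-unique : AtMostOneTree (longArcInside A v₁ u₂ v₂)
      inside-unique {node ts} {node ts′} vt vt′ =
        List.∷-injectiveˡ (cong children (twoFoldable-pigeonhole two
          (A , _ , u , twoArcs-long A v₁ u₂ v₂ u , vt , vh) (A , _ , u , twoArcs-long A v₁ u₂ v₂ u , vt′ , vh)
          (tree₁-valid A vf₁ vf₂ vg₂ vh) (tree₁-first-shorter vt) (tree₁-first-shorter vt′)))

      rest≤2 : ∀ E → crossings E (shortArcRest A u₂ v₂ u) N ≤ 2
      rest≤2 = atMostOneTree⇒crossings≤2 _ N-reduced ⋆-shortArcRest rest-unique

      inside≤2 : ∀ E → crossings E (longArcInside A v₁ u₂ v₂) F ≤ 2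
      inside≤2 = atMostOneTree⇒crossings≤2 _ F-reduced
                   (ValidF-closed (f₁ ++ node f₂ ∷ g₂) (longArcInside-valid A vf₁ vf₂ vg₂) F-reduced) inside-unique

      outer≤rest : ∀ E → crossings E (outerWord A u₂ u) N ≤ crossings E (shortArcRest A u₂ v₂ u) N
      outer≤rest E rewrite crossings-outer E | crossings-shortArcRest E =
        ℕ.+-monoʳ-≤ (b E) (ℕ.+-monoʳ-≤ (i E) (ℕ.m≤n+m (i E + d E) (c E)))

      inner≤inside : ∀ E → crossings E (innerWord A v₁ v₂) N ≤ crossings E (longArcInside A v₁ u₂ v₂) F
      inner≤inside E rewrite crossings-inner E | crossings-longArcInside E =
        ℕ.+-monoʳ-≤ (a E) (ℕ.+-monoʳ-≤ (i E) (ℕ.m≤n+m (i E + c E) (b E)))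

  outerWord-forest : ∀ A {u₂ u} → Forest u₂ → Forest u → Forest (outerWord A u₂ u)
  outerWord-forest A (f₂ , vf₂) (h , vh) =
    f₂ ++ node [] ∷ h , ValidF-++ f₂ (node [] ∷ h) vf₂ (A , [] , _ , refl , refl , vh)

  innerWord-forest : ∀ A {v₁ v₂} → Forest v₁ → Forest v₂ → Forest (innerWord A v₁ v₂)
  innerWord-forest A {v₁} {v₂} (f₁ , vf₁) (g₂ , vg₂) =
    [ node (f₁ ++ g₂) ] , A , v₁ ++ v₂ , [] , cong (A ∷_) (sym (List.++-assoc v₁ v₂ [ comp A ])) ,
    ValidF-++ f₁ g₂ vf₁ vg₂ , refl

  forests⇒arcsClosed : ∀ A {v₁ u₂ v₂ u} → Forest v₁ → Forest u₂ → Forest v₂ → Forest u →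
                       ArcsClosed A v₁ u₂ v₂ u []
  forests⇒arcsClosed A (f₁ , vf₁) (f₂ , vf₂) (g₂ , vg₂) (h , vh) = record
    { N-reduced = [] ; v₁-closed = ValidF-closed f₁ vf₁ F-reduced ; u₂-closed = ValidF-closed f₂ vf₂ []
    ; v₂-closed = ValidF-closed g₂ vg₂ F-reduced ; u-closed = ValidF-closed h vh [] }
    where
    F-reduced : Reduced (comp A ∙ [])
    F-reduced = ∙-reduced (comp A) []

  outer-rotation : ∀ A u₁ u₂ u₃ → (u₁ ++ u₂ ++ A ∷ comp A ∷ u₃) ≅ outerWord A u₂ (u₃ ++ u₁)
  outer-rotation A u₁ u₂ u₃ = ≅-trans (++-comm-≅ u₁ _) (≡⇒≅ (List.++-assoc u₂ (A ∷ comp A ∷ u₃) u₁))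

  decomposition⇒ADecomposition : ∀ {w} → Decomposition w → KFoldable 2 w → ADecomposition w
  decomposition⇒ADecomposition D two
    with fv₁ , fu₂ , fv₂ , fu ← arcForests (Decomposition.closed D)
    with outer≤2 , inner≤2
           ← Arcs.twoArcs-twoFoldable⁻ (Decomposition.closed D) (≅-kFoldable 2 (Decomposition.rotation D) two) =
    A , u₁ , u₂ , u₃ , v₁ , v₂ , split ,
    ≅-foldable (++-comm-≅ u₃ u₁) (forest⇒foldable fu) ,
    forest⇒foldable fu₂ , forest⇒foldable fv₁ , forest⇒foldable fv₂ ,
    ≅-kFoldable 1 (≅-sym (outer-rotation A u₁ u₂ u₃))
      (Equivalence.from (oneFoldable⇔crossings≤2 (outerWord-forest A fu₂ fu) N-reduced) outer≤2) ,
    Equivalence.from (oneFoldable⇔crossings≤2 (innerWord-forest A fv₁ fv₂) N-reduced) inner≤2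
    where
    open Decomposition D
    open ArcsClosed closed using (N-reduced)

  twoFoldable⇒ADecomposition : ∀ w → KFoldable 2 w → ADecomposition w
  twoFoldable⇒ADecomposition w two with twoFoldable-elim two
  ... | node ps , node qs , vP , vQ , P≢Q , _ with crossings≤2? w []
  ...   | inj₁ ≤2 = ⊥-elim (P≢Q (cong node (crossings≤2⇒unique ps qs [] ≤2 vP vQ)))
  ...   | inj₂ (E , ≥3) =
    decomposition⇒ADecomposition (crossings≥3⇒decomposition E w [] (ValidF-closed ps vP []) ≥3) two

  ADecomposition⇒twoFoldable : ∀ w → ADecomposition w → KFoldable 2 w
  ADecomposition⇒twoFoldable w (A , u₁ , u₂ , u₃ , v₁ , v₂ , split , fu₁u₃ , fu₂ , fv₁ , fv₂ , outer₁ , inner₁) =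
    ≅-kFoldable 2 (≅-sym (≅-trans (≡⇒≅ split) (twoArcs-rotation A u₁ v₁ u₂ v₂ u₃)))
      (Arcs.twoArcs-twoFoldable (forests⇒arcsClosed A Fv₁ Fu₂ Fv₂ Fu)
        (Equivalence.to (oneFoldable⇔crossings≤2 (outerWord-forest A Fu₂ Fu) [])
          (≅-kFoldable 1 (outer-rotation A u₁ u₂ u₃) outer₁))
        (Equivalence.to (oneFoldable⇔crossings≤2 (innerWord-forest A Fv₁ Fv₂) []) inner₁))
    where
    Fu : Forest (u₃ ++ u₁)
    Fu = foldable⇒forest (≅-foldable (++-comm-≅ u₁ u₃) fu₁u₃)
    Fu₂ : Forest u₂
    Fu₂ = foldable⇒forest fu₂
    Fv₁ : Forest v₁
    Fv₁ = foldable⇒forest fv₁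
    Fv₂ : Forest v₂
    Fv₂ = foldable⇒forest fv₂

mainTheorem8 : (m : ℕ) (w : Word m) → KFoldable 2 w ⇔ ADecomposition w
mainTheorem8 m w = mk⇔ (twoFoldable⇒ADecomposition w) (ADecomposition⇒twoFoldable w)
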